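{- Let $H$ be a generalized $b$-happy function with digit mean $\mu$ and digit variance $\sigma^2$. There exists $N$ such that for every $n>N$ and every $n$-strict integer interval $I$, there exists $m\in\mathbb{N}$ with \[\big[\mu m-\sigma m^{5/8},\ \mu m+\sigma m^{5/8}\big]\subseteq I\] (as integer intervals).
   Context: Fix an integer $b>1$ and non-negative integers $h(0),\dots,h(b-1)$ with $h(0)=0$, $h(1)=1$. The generalized $b$-happy function with digit sequence $h$ is $H(n)=\sum_i h(a_i)$ where $n=\sum_i a_ib^i$ is the base-$b$ expansion. Its digit mean and digit variance are $\mu=\frac1b\sum_{j=0}^{b-1}h(j)$ and $\sigma^2=\frac1b\sum_{j=0}^{b-1}(h(j)-\mu)^2$. For real $a\le c$, the integer interval $[a,c]$ is the set of positive integers $m$ with $a\le m\le c$; $|I|$ is its cardinality. An integer interval $I$ is $n$-strict if $I\subseteq[b^{n-1},b^n-1]$ and $|I|=b^{3n/4}$. -}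

module Defs where

open import Data.Nat as ℕ using (ℕ; zero; suc; _≤_; _<_; NonZero)
open import Data.Fin using (Fin; toℕ)
open import Data.Integer using (+_)
open import Data.Rational using (ℚ; _+_; _*_; _-_; _/_; 0ℚ; 1ℚ)
open import Data.List using (List; sum; map)

Σ<ℚ : (b : ℕ) → (ℕ → ℚ) → ℚ
Σ<ℚ zero    f = 0ℚ
Σ<ℚ (suc b) f = Σ<ℚ b f + f b

Σ<ℕ : (b : ℕ) → (ℕ → ℕ) → ℕ
Σ<ℕ zero    f = 0
Σ<ℕ (suc b) f = Σ<ℕ b f ℕ.+ f b

_^ℚ_ : ℚ → ℕ → ℚ
q ^ℚ zero  = 1ℚ
q ^ℚ suc n = q * (q ^ℚ n)

⟦_⟧ : ℕ → ℚ
⟦ n ⟧ = (+ n) / 1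

-- Generalized b-happy function: H(n) = Σ h(a_i), a_i the base-b digits of n.
-- (Defined for completeness; not used in the statement. Fuel n suffices since
-- n has at most n base-b digits.)
happyAux : (b : ℕ) .{{_ : NonZero b}} → (h : ℕ → ℕ) → (fuel n : ℕ) → ℕ
happyAux b h zero       n = 0
happyAux b h (suc fuel) n = h (n ℕ.% b) ℕ.+ happyAux b h fuel (n ℕ./ b)

H : (b : ℕ) .{{_ : NonZero b}} → (h : ℕ → ℕ) → ℕ → ℕ
H b h n = happyAux b h n n

digitMean : (b : ℕ) .{{_ : NonZero b}} → (h : ℕ → ℕ) → ℚ
digitMean b h = Σ<ℚ b (λ j → ⟦ h j ⟧) * ((+ 1) / b)

digitVariance : (b : ℕ) .{{_ : NonZero b}} → (h : ℕ → ℕ) → ℚ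
digitVariance b h =
  Σ<ℚ b (λ j → (⟦ h j ⟧ - digitMean b h) * (⟦ h j ⟧ - digitMean b h)) * ((+ 1) / b)

-- Membership of a positive integer k in the integer interval
-- [μ m - σ m^{5/8}, μ m + σ m^{5/8}], i.e. |k - μ m| ≤ σ m^{5/8},
-- equivalently (both sides non-negative) (k - μ m)^8 ≤ (σ²)^4 · m^5.
inHappyWindow : (b : ℕ) .{{_ : NonZero b}} → (h : ℕ → ℕ) → (m k : ℕ) → Set
inHappyWindow b h m k =
  1 ≤ k × ((⟦ k ⟧ - digitMean b h * ⟦ m ⟧) ^ℚ 8 Data.Rational.≤ (digitVariance b h ^ℚ 4) * (⟦ m ⟧ ^ℚ 5))
  where open import Data.Product using (_×_)

-- The integer interval {lo, ..., hi} (positive integers, lo ≥ 1) is n-strict: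
-- it lies in [b^{n-1}, b^n - 1] and its cardinality c = hi + 1 - lo satisfies c = b^{3n/4},
-- i.e. c^4 = b^{3n}.
nStrict : (b n lo hi : ℕ) → Set
nStrict b n lo hi =
  (b ℕ.^ (n ℕ.∸ 1) ≤ lo) × (lo ≤ hi) × (hi ℕ.+ 1 ≤ b ℕ.^ n)
  × ((suc hi ℕ.∸ lo) ℕ.^ 4 ≡ b ℕ.^ (3 ℕ.* n))
  where open import Data.Product using (_×_)
        open import Relation.Binary.PropositionalEquality using (_≡_)

module Submission where

-- Write S = Σ_{j<b} h(j), so that μ = S/b and σ² ≤ S² (each digit value and μ
-- lie in [0, S]).  Let c = hi + 1 - lo, q = ⌊c/2⌋ and take the centre
-- m = ⌊b(lo + q)/S⌋, so that S·m is within S of b·(lo + q).  Multiplying the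
-- window condition (k - μm)^8 ≤ σ^8 m^5 by b^8 clears the denominator of μ:
-- every window point k satisfies |bk - Sm|^8 ≤ b^8 S^8 m^5 =: W(m).  A point
-- k < lo or k ≥ lo + 2q has |bk - Sm| ≥ q, so no such k exists once W(m) < q^8.
-- Strictness gives c^8 = X^6 with X = b^n, and m ≤ bX, so W(m) ≤ W(b)·X^5 while
-- q^8 ≥ (c/3)^8 = X^6/3^8: the window fits as soon as X > 3^8 W(b) + (2S)^8.

open import Defs
open import Data.Nat
  using (ℕ; zero; suc; z≤n; s≤s; _≤_; _<_; _+_; _*_; _^_; _∸_; NonZero; >-nonZero; >-nonZero⁻¹)
import Data.Nat.Properties as ℕP
open import Data.Nat.DivMod using (_/_; _%_; m≡m%n+[m/n]*n; m%n<n; m/n*n≤m; m≥n⇒m/n>0)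
import Data.Nat.Solver as ℕSolver
import Data.Integer as ℤ
import Data.Integer.Properties as ℤP
open import Data.Rational as ℚ using (ℚ; mkℚ; 0ℚ; 1ℚ; -_)
import Data.Rational.Properties as ℚP
import Data.Rational.Solver as ℚSolver
import Data.Nat.Coprimality as Coprime
open import Data.Product using (∃-syntax; _×_; _,_)
open import Data.Sum using (_⊎_; inj₁; inj₂)
open import Data.Empty using (⊥)
open import Relation.Binary.PropositionalEquality
  using (_≡_; refl; sym; trans; cong; cong₂; subst; subst₂; module ≡-Reasoning)

⟦⟧≡mkℚ : ∀ n → ⟦ n ⟧ ≡ mkℚ (ℤ.+ n) 0 (Coprime.sym (Coprime.1-coprimeTo n))
⟦⟧≡mkℚ n = ℚP.normalize-coprime (Coprime.sym (Coprime.1-coprimeTo n))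

⟦+⟧ : ∀ m n → ⟦ m + n ⟧ ≡ ⟦ m ⟧ ℚ.+ ⟦ n ⟧
⟦+⟧ m n rewrite ⟦⟧≡mkℚ m | ⟦⟧≡mkℚ n | ℤP.*-identityʳ (ℤ.+ m) | ℤP.*-identityʳ (ℤ.+ n) = refl

⟦*⟧ : ∀ m n → ⟦ m * n ⟧ ≡ ⟦ m ⟧ ℚ.* ⟦ n ⟧
⟦*⟧ m n rewrite ⟦⟧≡mkℚ m | ⟦⟧≡mkℚ n | sym (ℤP.pos-* m n) = refl

⟦^⟧ : ∀ m n → ⟦ m ^ n ⟧ ≡ ⟦ m ⟧ ^ℚ n
⟦^⟧ m zero    = refl
⟦^⟧ m (suc n) = trans (⟦*⟧ m (m ^ n)) (cong (⟦ m ⟧ ℚ.*_) (⟦^⟧ m n))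

⟦⟧-mono-≤ : ∀ {m n} → m ≤ n → ⟦ m ⟧ ℚ.≤ ⟦ n ⟧
⟦⟧-mono-≤ {m} {n} m≤n rewrite ⟦⟧≡mkℚ m | ⟦⟧≡mkℚ n =
  ℚ.*≤* (subst₂ ℤ._≤_ (sym (ℤP.*-identityʳ (ℤ.+ m))) (sym (ℤP.*-identityʳ (ℤ.+ n)))
                 (ℤ.+≤+ m≤n))

⟦⟧-cancel-≤ : ∀ {m n} → ⟦ m ⟧ ℚ.≤ ⟦ n ⟧ → m ≤ n
⟦⟧-cancel-≤ {m} {n} ⟦m⟧≤⟦n⟧ rewrite ⟦⟧≡mkℚ m | ⟦⟧≡mkℚ n with ⟦m⟧≤⟦n⟧
... | ℚ.*≤* m*1≤n*1 =
  ℤP.drop‿+≤+ (subst₂ ℤ._≤_ (ℤP.*-identityʳ (ℤ.+ m)) (ℤP.*-identityʳ (ℤ.+ n)) m*1≤n*1)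

⟦⟧-nonNeg : ∀ n → 0ℚ ℚ.≤ ⟦ n ⟧
⟦⟧-nonNeg n = ⟦⟧-mono-≤ {0} {n} z≤n

1/b*b≡1 : ∀ b .{{_ : NonZero b}} → ((ℤ.+ 1) ℚ./ b) ℚ.* ⟦ b ⟧ ≡ 1ℚ
1/b*b≡1 (suc b) rewrite ⟦⟧≡mkℚ (suc b) | ℚP.normalize-coprime {1} {b} (Coprime.1-coprimeTo (suc b)) =
  ℚP.*-inverseˡ (mkℚ (ℤ.+ suc b) 0 (Coprime.sym (Coprime.1-coprimeTo (suc b))))

module _ where
  open ℚSolver.+-*-Solver using (solve; _:=_; _:+_; _:*_; _:-_; :-_; _:^_)

  *-nonNeg : ∀ {x y} → 0ℚ ℚ.≤ x → 0ℚ ℚ.≤ y → 0ℚ ℚ.≤ x ℚ.* y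
  *-nonNeg {x} {y} 0≤x 0≤y =
    ℚP.nonNegative⁻¹ (x ℚ.* y) {{ℚP.nonNeg*nonNeg⇒nonNeg x {{ℚ.nonNegative 0≤x}} y {{ℚ.nonNegative 0≤y}}}}

  +-nonNeg : ∀ {x y} → 0ℚ ℚ.≤ x → 0ℚ ℚ.≤ y → 0ℚ ℚ.≤ x ℚ.+ y
  +-nonNeg 0≤x 0≤y = ℚP.+-mono-≤ 0≤x 0≤y

  ^-nonNeg : ∀ {x} n → 0ℚ ℚ.≤ x → 0ℚ ℚ.≤ x ^ℚ n
  ^-nonNeg zero    _   = ⟦⟧-nonNeg 1
  ^-nonNeg (suc n) 0≤x = *-nonNeg 0≤x (^-nonNeg n 0≤x)

  ^-mono-≤ : ∀ {x y} n → 0ℚ ℚ.≤ x → x ℚ.≤ y → x ^ℚ n ℚ.≤ y ^ℚ n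
  ^-mono-≤ zero    _   _   = ℚP.≤-refl
  ^-mono-≤ {x} {y} (suc n) 0≤x x≤y =
    ℚP.≤-trans (ℚP.*-monoʳ-≤-nonNeg (x ^ℚ n) {{ℚ.nonNegative (^-nonNeg n 0≤x)}} x≤y)
               (ℚP.*-monoˡ-≤-nonNeg y {{ℚ.nonNegative (ℚP.≤-trans 0≤x x≤y)}} (^-mono-≤ n 0≤x x≤y))

  sq-nonNeg : ∀ x → 0ℚ ℚ.≤ x ℚ.* x
  sq-nonNeg x with ℚP.≤-total 0ℚ x
  ... | inj₁ 0≤x = *-nonNeg 0≤x 0≤x
  ... | inj₂ x≤0 = subst (0ℚ ℚ.≤_) (solve 1 (λ x → (:- x) :* (:- x) := x :* x) refl x)
                         (*-nonNeg 0≤-x 0≤-x)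
    where 0≤-x = ℚP.neg-antimono-≤ x≤0

  ≤⇒0≤- : ∀ {x y} → x ℚ.≤ y → 0ℚ ℚ.≤ y ℚ.- x
  ≤⇒0≤- {x} {y} x≤y = subst (ℚ._≤ y ℚ.- x) (ℚP.+-inverseʳ x) (ℚP.+-monoˡ-≤ (- x) x≤y)

  0≤-⇒≤ : ∀ {x y} → 0ℚ ℚ.≤ y ℚ.- x → x ℚ.≤ y
  0≤-⇒≤ {x} {y} 0≤y-x = subst₂ ℚ._≤_ (ℚP.+-identityˡ x)
    (solve 2 (λ x y → (y :- x) :+ x := y) refl x y) (ℚP.+-monoˡ-≤ x 0≤y-x)

  -- Two points of [0, s] are at squared distance at most s², since
  -- s² - (x - y)² = (s - x + y)(s - y + x) is a product of non-negatives.
  sq-diff-≤ : ∀ {s x y} → 0ℚ ℚ.≤ x → x ℚ.≤ s → 0ℚ ℚ.≤ y → y ℚ.≤ s →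
              (x ℚ.- y) ℚ.* (x ℚ.- y) ℚ.≤ s ℚ.* s
  sq-diff-≤ {s} {x} {y} 0≤x x≤s 0≤y y≤s = 0≤-⇒≤ (subst (0ℚ ℚ.≤_) factorise
    (*-nonNeg (+-nonNeg (≤⇒0≤- x≤s) 0≤y) (+-nonNeg (≤⇒0≤- y≤s) 0≤x)))
    where
    factorise = solve 3 (λ s x y → ((s :- x) :+ y) :* ((s :- y) :+ x)
                                   := s :* s :- (x :- y) :* (x :- y)) refl s x y

  ^8-neg : ∀ x → (- x) ^ℚ 8 ≡ x ^ℚ 8
  ^8-neg = solve 1 (λ x → (:- x) :^ 8 := x :^ 8) refl

  ^8-* : ∀ x y → (x ℚ.* y) ^ℚ 8 ≡ x ^ℚ 8 ℚ.* y ^ℚ 8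
  ^8-* = solve 2 (λ x y → (x :* y) :^ 8 := x :^ 8 :* y :^ 8) refl

  gap⇒≤- : ∀ {d x y} → d + x ≤ y → ⟦ d ⟧ ℚ.≤ ⟦ y ⟧ ℚ.- ⟦ x ⟧
  gap⇒≤- {d} {x} {y} d+x≤y = 0≤-⇒≤ (subst (0ℚ ℚ.≤_) regroup (≤⇒0≤- (⟦⟧-mono-≤ d+x≤y)))
    where
    regroup = trans (cong (λ z → ⟦ y ⟧ ℚ.- z) (⟦+⟧ d x))
                    (solve 3 (λ d x y → y :- (d :+ x) := (y :- x) :- d) refl ⟦ d ⟧ ⟦ x ⟧ ⟦ y ⟧)

  gap⇒^8-≤ : ∀ d x y → d + x ≤ y ⊎ d + y ≤ x → ⟦ d ⟧ ^ℚ 8 ℚ.≤ (⟦ x ⟧ ℚ.- ⟦ y ⟧) ^ℚ 8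
  gap⇒^8-≤ d x y (inj₁ d+x≤y) = subst (⟦ d ⟧ ^ℚ 8 ℚ.≤_) (trans (cong (_^ℚ 8) swap) (^8-neg (⟦ x ⟧ ℚ.- ⟦ y ⟧)))
                                      (^-mono-≤ 8 (⟦⟧-nonNeg d) (gap⇒≤- {d} {x} {y} d+x≤y))
    where swap = solve 2 (λ x y → y :- x := :- (x :- y)) refl ⟦ x ⟧ ⟦ y ⟧
  gap⇒^8-≤ d x y (inj₂ d+y≤x) = ^-mono-≤ 8 (⟦⟧-nonNeg d) (gap⇒≤- {d} {y} {x} d+y≤x)

term≤Σ<ℕ : ∀ (f : ℕ → ℕ) n j → j < n → f j ≤ Σ<ℕ n f
term≤Σ<ℕ f (suc n) j j<1+n with ℕP.m<1+n⇒m<n∨m≡n j<1+n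
... | inj₁ j<n  = ℕP.≤-trans (term≤Σ<ℕ f n j j<n) (ℕP.m≤m+n (Σ<ℕ n f) (f n))
... | inj₂ refl = ℕP.m≤n+m (f j) (Σ<ℕ j f)

Σ<ℚ-⟦⟧ : ∀ (f : ℕ → ℕ) n → Σ<ℚ n (λ j → ⟦ f j ⟧) ≡ ⟦ Σ<ℕ n f ⟧
Σ<ℚ-⟦⟧ f zero    = refl
Σ<ℚ-⟦⟧ f (suc n) = trans (cong (ℚ._+ ⟦ f n ⟧) (Σ<ℚ-⟦⟧ f n)) (sym (⟦+⟧ (Σ<ℕ n f) (f n)))

Σ<ℚ-nonNeg : ∀ (f : ℕ → ℚ) n → (∀ j → j < n → 0ℚ ℚ.≤ f j) → 0ℚ ℚ.≤ Σ<ℚ n f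
Σ<ℚ-nonNeg f zero    _   = ℚP.≤-refl
Σ<ℚ-nonNeg f (suc n) 0≤f =
  +-nonNeg (Σ<ℚ-nonNeg f n (λ j j<n → 0≤f j (ℕP.m<n⇒m<1+n j<n))) (0≤f n ℕP.≤-refl)

Σ<ℚ-≤ : ∀ (f : ℕ → ℚ) c n → (∀ j → j < n → f j ℚ.≤ c) → Σ<ℚ n f ℚ.≤ ⟦ n ⟧ ℚ.* c
Σ<ℚ-≤ f c zero    _   = ℚP.≤-reflexive (sym (ℚP.*-zeroˡ c))
Σ<ℚ-≤ f c (suc n) f≤c = begin
  Σ<ℚ n f ℚ.+ f n          ≤⟨ ℚP.+-mono-≤ (Σ<ℚ-≤ f c n (λ j j<n → f≤c j (ℕP.m<n⇒m<1+n j<n))) (f≤c n ℕP.≤-refl) ⟩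
  ⟦ n ⟧ ℚ.* c ℚ.+ c        ≡⟨ cong (⟦ n ⟧ ℚ.* c ℚ.+_) (ℚP.*-identityˡ c) ⟨
  ⟦ n ⟧ ℚ.* c ℚ.+ 1ℚ ℚ.* c ≡⟨ ℚP.*-distribʳ-+ c ⟦ n ⟧ 1ℚ ⟨
  (⟦ n ⟧ ℚ.+ 1ℚ) ℚ.* c     ≡⟨ cong (ℚ._* c) (sym (⟦+⟧ n 1)) ⟩
  ⟦ n + 1 ⟧ ℚ.* c          ≡⟨ cong (λ k → ⟦ k ⟧ ℚ.* c) (ℕP.+-comm n 1) ⟩
  ⟦ suc n ⟧ ℚ.* c          ∎
  where open ℚP.≤-Reasoning

centre : (b S lo q : ℕ) .{{_ : NonZero S}} → ℕ
centre b S lo q = b * (lo + q) / S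

module _ (b S lo q : ℕ) .{{_ : NonZero S}} where
  open ℕSolver.+-*-Solver using (solve; _:=_; _:+_; _:*_; con)
  open ℕP.≤-Reasoning

  private
    m = centre b S lo q

  S*centre≤ : S * m ≤ b * (lo + q)
  S*centre≤ = subst (_≤ b * (lo + q)) (ℕP.*-comm m S) (m/n*n≤m (b * (lo + q)) S)

  <S*centre+S : b * (lo + q) < S * m + S
  <S*centre+S = begin-strict
    b * (lo + q)              ≡⟨ m≡m%n+[m/n]*n (b * (lo + q)) S ⟩
    b * (lo + q) % S + m * S  <⟨ ℕP.+-monoˡ-< (m * S) (m%n<n (b * (lo + q)) S) ⟩
    S + m * S                 ≡⟨ solve 2 (λ S m → S :+ m :* S := S :* m :+ S) refl S m ⟩
    S * m + S                 ∎

  centre≤ : m ≤ b * (lo + q)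
  centre≤ = ℕP.≤-trans (ℕP.m≤n*m m S) S*centre≤

  centre-positive : 1 ≤ b → S ≤ q → 1 ≤ m
  centre-positive 1≤b S≤q = m≥n⇒m/n>0 (begin
    S             ≤⟨ S≤q ⟩
    q             ≤⟨ ℕP.m≤n+m q lo ⟩
    lo + q        ≡⟨ ℕP.*-identityˡ (lo + q) ⟨
    1 * (lo + q)  ≤⟨ ℕP.*-monoˡ-≤ (lo + q) 1≤b ⟩
    b * (lo + q)  ∎)

  centre-left : 1 < b → S ≤ q → ∀ k → k ≤ lo → q + b * k ≤ S * m
  centre-left 1<b S≤q k k≤lo = ℕP.<⇒≤ (ℕP.+-cancelʳ-< S (q + b * k) (S * m) (begin-strict
    q + b * k + S    ≤⟨ ℕP.+-mono-≤ (ℕP.+-monoʳ-≤ q (ℕP.*-monoʳ-≤ b k≤lo)) S≤q ⟩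
    q + b * lo + q   ≡⟨ solve 3 (λ q b lo → q :+ b :* lo :+ q := b :* lo :+ con 2 :* q) refl q b lo ⟩
    b * lo + 2 * q   ≤⟨ ℕP.+-monoʳ-≤ (b * lo) (ℕP.*-monoˡ-≤ q 1<b) ⟩
    b * lo + b * q   ≡⟨ ℕP.*-distribˡ-+ b lo q ⟨
    b * (lo + q)     <⟨ <S*centre+S ⟩
    S * m + S        ∎))

  centre-right : 1 ≤ b → ∀ k → lo + q * 2 ≤ k → q + S * m ≤ b * k
  centre-right 1≤b k lo+2q≤k = begin
    q + S * m             ≡⟨ cong (_+ S * m) (ℕP.*-identityˡ q) ⟨
    1 * q + S * m         ≤⟨ ℕP.+-mono-≤ (ℕP.*-monoˡ-≤ q 1≤b) S*centre≤ ⟩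
    b * q + b * (lo + q)  ≡⟨ solve 3 (λ q b lo → b :* q :+ b :* (lo :+ q) := b :* (lo :+ q :* con 2)) refl q b lo ⟩
    b * (lo + q * 2)      ≤⟨ ℕP.*-monoʳ-≤ b lo+2q≤k ⟩
    b * k                 ∎

-- W(m) = b^8 (S²)^4 m^5 bounds (b·k - S·m)^8 for the window points k of m.
windowBound : (b S m : ℕ) → ℕ
windowBound b S m = b ^ 8 * ((S * S) ^ 4 * m ^ 5)

threshold : (b S : ℕ) → ℕ
threshold b S = 3 ^ 8 * windowBound b S b + (S * 2) ^ 8

count radius : (lo hi : ℕ) → ℕ
count lo hi  = suc hi ∸ lo
radius lo hi = count lo hi / 2

module _ where
  open ℕSolver.+-*-Solver using (solve; _:=_; _:*_; _:+_; _:^_; con)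
  open ℕP.≤-Reasoning

  n<b^n : ∀ b n → 1 < b → n < b ^ n
  n<b^n b zero    _   = s≤s z≤n
  n<b^n b (suc n) 1<b = begin
    1 + suc n      ≤⟨ ℕP.+-mono-≤ (ℕP.≤-trans (s≤s z≤n) (n<b^n b n 1<b)) (n<b^n b n 1<b) ⟩
    b ^ n + b ^ n  ≡⟨ cong (b ^ n +_) (ℕP.+-identityʳ (b ^ n)) ⟨
    2 * b ^ n      ≤⟨ ℕP.*-monoˡ-≤ (b ^ n) 1<b ⟩
    b * b ^ n      ∎

  windowBound-mono : ∀ b S {m m′} → m ≤ m′ → windowBound b S m ≤ windowBound b S m′
  windowBound-mono b S m≤m′ = ℕP.*-monoʳ-≤ (b ^ 8) (ℕP.*-monoʳ-≤ ((S * S) ^ 4) (ℕP.^-monoˡ-≤ 5 m≤m′))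

  windowBound-scale : ∀ b S X → windowBound b S (b * X) ≡ windowBound b S b * X ^ 5
  windowBound-scale = solve 3 (λ b S X → b :^ 8 :* ((S :* S) :^ 4 :* (b :* X) :^ 5)
                                       := b :^ 8 :* ((S :* S) :^ 4 :* b :^ 5) :* X :^ 5) refl

  count^8 : ∀ b n lo hi → nStrict b n lo hi → count lo hi ^ 8 ≡ (b ^ n) ^ 6
  count^8 b n lo hi (_ , _ , _ , c^4≡) = begin-equality
    c ^ 8                      ≡⟨ ℕP.^-distribˡ-+-* c 4 4 ⟩
    c ^ 4 * c ^ 4              ≡⟨ cong₂ _*_ c^4≡ c^4≡ ⟩
    b ^ (3 * n) * b ^ (3 * n)  ≡⟨ ℕP.^-distribˡ-+-* b (3 * n) (3 * n) ⟨
    b ^ (3 * n + 3 * n)        ≡⟨ cong (b ^_) (solve 1 (λ n → con 3 :* n :+ con 3 :* n := n :* con 6) refl n) ⟩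
    b ^ (n * 6)                ≡⟨ ℕP.^-*-assoc b n 6 ⟨
    (b ^ n) ^ 6                ∎
    where c = count lo hi

  radius*2≤count : ∀ lo hi → radius lo hi * 2 ≤ count lo hi
  radius*2≤count lo hi = m/n*n≤m (count lo hi) 2

  count≤radius*2+1 : ∀ lo hi → count lo hi ≤ suc (radius lo hi * 2)
  count≤radius*2+1 lo hi = begin
    c                  ≡⟨ m≡m%n+[m/n]*n c 2 ⟩
    c % 2 + c / 2 * 2  ≤⟨ ℕP.+-monoˡ-≤ (c / 2 * 2) (ℕP.<⇒≤pred (m%n<n c 2)) ⟩
    suc (c / 2 * 2)    ∎
    where c = count lo hi

  radius-fits : ∀ lo hi → lo ≤ hi → lo + radius lo hi * 2 ≤ suc hi
  radius-fits lo hi lo≤hi = begin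
    lo + radius lo hi * 2  ≤⟨ ℕP.+-monoʳ-≤ lo (radius*2≤count lo hi) ⟩
    lo + count lo hi       ≡⟨ ℕP.m+[n∸m]≡n (ℕP.m≤n⇒m≤1+n lo≤hi) ⟩
    suc hi                 ∎

  midpoint≤b^n : ∀ b n lo hi → nStrict b n lo hi → lo + radius lo hi ≤ b ^ n
  midpoint≤b^n b n lo hi (_ , lo≤hi , hi+1≤b^n , _) = begin
    lo + radius lo hi      ≤⟨ ℕP.+-monoʳ-≤ lo (ℕP.m≤m*n (radius lo hi) 2) ⟩
    lo + radius lo hi * 2  ≤⟨ radius-fits lo hi lo≤hi ⟩
    suc hi                 ≡⟨ ℕP.+-comm 1 hi ⟩
    hi + 1                 ≤⟨ hi+1≤b^n ⟩
    b ^ n                  ∎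

  -- The core estimate behind the choice of threshold: if 3^8·A < X, c^8 = X^6
  -- and c ≤ 3q, then A·X^5 < X^6/3^8 ≤ q^8.
  power-gap : ∀ A X c q .{{_ : NonZero X}} → 3 ^ 8 * A < X → c ^ 8 ≡ X ^ 6 → c ≤ 3 * q →
              A * X ^ 5 < q ^ 8
  power-gap A X c q 3^8A<X c^8≡X^6 c≤3q = ℕP.*-cancelˡ-< (3 ^ 8) (A * X ^ 5) (q ^ 8) (begin-strict
    3 ^ 8 * (A * X ^ 5)  ≡⟨ ℕP.*-assoc (3 ^ 8) A (X ^ 5) ⟨
    3 ^ 8 * A * X ^ 5    <⟨ ℕP.*-monoˡ-< (X ^ 5) {{ℕP.m^n≢0 X 5}} 3^8A<X ⟩
    X ^ 6                ≡⟨ c^8≡X^6 ⟨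
    c ^ 8                ≤⟨ ℕP.^-monoˡ-≤ 8 c≤3q ⟩
    (3 * q) ^ 8          ≡⟨ solve 1 (λ q → (con 3 :* q) :^ 8 := con 3 :^ 8 :* q :^ 8) refl q ⟩
    3 ^ 8 * q ^ 8        ∎)

module StrictInterval (b S n lo hi : ℕ) .{{_ : NonZero b}} (1<b : 1 < b)
                      (N<n : threshold b S < n) (strictness : nStrict b n lo hi) where
  open ℕP.≤-Reasoning

  private
    X = b ^ n
    q = radius lo hi
    instance
      X≢0 : NonZero X
      X≢0 = ℕP.m^n≢0 b n

    threshold<X : threshold b S < X
    threshold<X = ℕP.<-trans N<n (n<b^n b n 1<b)

  -- Since c^8 = X^6 ≥ X > (2S)^8, the radius is at least S.
  S≤radius : S ≤ q
  S≤radius = ℕP.≮⇒≥ λ q<S → ℕP.<⇒≱ (begin-strict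
    (S * 2) ^ 8      ≤⟨ ℕP.m≤n+m ((S * 2) ^ 8) (3 ^ 8 * windowBound b S b) ⟩
    threshold b S    <⟨ threshold<X ⟩
    X                ≤⟨ ℕP.m≤m*n X (X ^ 5) {{ℕP.m^n≢0 X 5}} ⟩
    X ^ 6            ≡⟨ count^8 b n lo hi strictness ⟨
    count lo hi ^ 8  ∎)
    (ℕP.^-monoˡ-≤ 8 (begin
      count lo hi      ≤⟨ count≤radius*2+1 lo hi ⟩
      suc (q * 2)      ≤⟨ ℕP.n≤1+n (suc (q * 2)) ⟩
      suc q * 2        ≤⟨ ℕP.*-monoˡ-≤ 2 q<S ⟩
      S * 2            ∎))

  -- Since c ≤ 2q + 1 ≤ 3q, power-gap applies with A = W(b).
  radius-dominates : 1 ≤ S → ∀ m → m ≤ b * X → windowBound b S m < q ^ 8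
  radius-dominates 1≤S m m≤bX = begin-strict
    windowBound b S m            ≤⟨ windowBound-mono b S m≤bX ⟩
    windowBound b S (b * X)      ≡⟨ windowBound-scale b S X ⟩
    windowBound b S b * X ^ 5    <⟨ power-gap (windowBound b S b) X (count lo hi) q
                                      (ℕP.≤-<-trans (ℕP.m≤m+n _ ((S * 2) ^ 8)) threshold<X)
                                      (count^8 b n lo hi strictness) c≤3q ⟩
    q ^ 8                        ∎
    where
    c≤3q : count lo hi ≤ 3 * q
    c≤3q = begin
      count lo hi      ≤⟨ count≤radius*2+1 lo hi ⟩
      1 + q * 2        ≤⟨ ℕP.+-monoˡ-≤ (q * 2) (ℕP.≤-trans 1≤S S≤radius) ⟩
      q + q * 2        ≡⟨ cong (q +_) (ℕP.*-comm q 2) ⟩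
      3 * q            ∎

module DigitStatistics (b : ℕ) .{{_ : NonZero b}} (h : ℕ → ℕ) where
  open ℚSolver.+-*-Solver using (solve; _:=_; _:-_; _:*_)

  S : ℕ
  S = Σ<ℕ b h

  μ σ² B 1/b : ℚ
  μ   = digitMean b h
  σ²  = digitVariance b h
  B   = ⟦ b ⟧
  1/b = (ℤ.+ 1) ℚ./ b

  1/b-nonNeg : 0ℚ ℚ.≤ 1/b
  1/b-nonNeg = ℚP.nonNegative⁻¹ 1/b {{ℚP.normalize-nonNeg 1 b}}

  μ*b≡S : μ ℚ.* B ≡ ⟦ S ⟧
  μ*b≡S = begin
    Σ<ℚ b (λ j → ⟦ h j ⟧) ℚ.* 1/b ℚ.* B    ≡⟨ ℚP.*-assoc (Σ<ℚ b (λ j → ⟦ h j ⟧)) 1/b B ⟩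
    Σ<ℚ b (λ j → ⟦ h j ⟧) ℚ.* (1/b ℚ.* B)  ≡⟨ cong (Σ<ℚ b (λ j → ⟦ h j ⟧) ℚ.*_) (1/b*b≡1 b) ⟩
    Σ<ℚ b (λ j → ⟦ h j ⟧) ℚ.* 1ℚ           ≡⟨ ℚP.*-identityʳ _ ⟩
    Σ<ℚ b (λ j → ⟦ h j ⟧)                  ≡⟨ Σ<ℚ-⟦⟧ h b ⟩
    ⟦ S ⟧                                  ∎
    where open ≡-Reasoning

  μ-nonNeg : 0ℚ ℚ.≤ μ
  μ-nonNeg = *-nonNeg (subst (0ℚ ℚ.≤_) (sym (Σ<ℚ-⟦⟧ h b)) (⟦⟧-nonNeg S)) 1/b-nonNeg

  μ≤S : μ ℚ.≤ ⟦ S ⟧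
  μ≤S = subst₂ ℚ._≤_ (ℚP.*-identityʳ μ) μ*b≡S
          (ℚP.*-monoˡ-≤-nonNeg μ {{ℚ.nonNegative μ-nonNeg}} (⟦⟧-mono-≤ (>-nonZero⁻¹ b)))

  deviation : ℕ → ℚ
  deviation j = (⟦ h j ⟧ ℚ.- μ) ℚ.* (⟦ h j ⟧ ℚ.- μ)

  deviation≤S² : ∀ j → j < b → deviation j ℚ.≤ ⟦ S ⟧ ℚ.* ⟦ S ⟧
  deviation≤S² j j<b =
    sq-diff-≤ (⟦⟧-nonNeg (h j)) (⟦⟧-mono-≤ (term≤Σ<ℕ h b j j<b)) μ-nonNeg μ≤S

  σ²-nonNeg : 0ℚ ℚ.≤ σ²
  σ²-nonNeg = *-nonNeg (Σ<ℚ-nonNeg deviation b (λ j _ → sq-nonNeg (⟦ h j ⟧ ℚ.- μ))) 1/b-nonNeg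

  σ²≤S² : σ² ℚ.≤ ⟦ S * S ⟧
  σ²≤S² = begin
    Σ<ℚ b deviation ℚ.* 1/b          ≤⟨ ℚP.*-monoʳ-≤-nonNeg 1/b {{ℚ.nonNegative 1/b-nonNeg}}
                                          (Σ<ℚ-≤ deviation S² b deviation≤S²) ⟩
    B ℚ.* S² ℚ.* 1/b                 ≡⟨ solve 3 (λ B s r → B :* s :* r := s :* (r :* B)) refl B S² 1/b ⟩
    S² ℚ.* (1/b ℚ.* B)               ≡⟨ cong (S² ℚ.*_) (1/b*b≡1 b) ⟩
    S² ℚ.* 1ℚ                        ≡⟨ ℚP.*-identityʳ S² ⟩
    S²                               ≡⟨ ⟦*⟧ S S ⟨
    ⟦ S * S ⟧                        ∎
    where open ℚP.≤-Reasoning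
          S² = ⟦ S ⟧ ℚ.* ⟦ S ⟧

  -- Multiplying the window condition (k - μm)^8 ≤ (σ²)^4 m^5 by b^8 clears
  -- the denominator of μ.
  window⇒scaled : ∀ m k → inHappyWindow b h m k →
                  (⟦ b * k ⟧ ℚ.- ⟦ S * m ⟧) ^ℚ 8 ℚ.≤ ⟦ windowBound b S m ⟧
  window⇒scaled m k (_ , window) = begin
    (⟦ b * k ⟧ ℚ.- ⟦ S * m ⟧) ^ℚ 8             ≡⟨ cong (_^ℚ 8) scale ⟩
    (B ℚ.* (K ℚ.- μ ℚ.* M)) ^ℚ 8               ≡⟨ ^8-* B (K ℚ.- μ ℚ.* M) ⟩
    B ^ℚ 8 ℚ.* (K ℚ.- μ ℚ.* M) ^ℚ 8            ≤⟨ ℚP.*-monoˡ-≤-nonNeg (B ^ℚ 8) {{ℚ.nonNegative (^-nonNeg 8 (⟦⟧-nonNeg b))}}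
                                                   (ℚP.≤-trans window variance≤) ⟩
    B ^ℚ 8 ℚ.* (⟦ S * S ⟧ ^ℚ 4 ℚ.* M ^ℚ 5)     ≡⟨ sym embed ⟩
    ⟦ windowBound b S m ⟧                      ∎
    where
    open ℚP.≤-Reasoning
    K = ⟦ k ⟧
    M = ⟦ m ⟧
    scale : ⟦ b * k ⟧ ℚ.- ⟦ S * m ⟧ ≡ B ℚ.* (K ℚ.- μ ℚ.* M)
    scale = trans (cong₂ ℚ._-_ (⟦*⟧ b k) (trans (⟦*⟧ S m) (cong (ℚ._* M) (sym μ*b≡S))))
                  (solve 4 (λ B K u M → B :* K :- (u :* B) :* M := B :* (K :- u :* M)) refl B K μ M)
    variance≤ : σ² ^ℚ 4 ℚ.* M ^ℚ 5 ℚ.≤ ⟦ S * S ⟧ ^ℚ 4 ℚ.* M ^ℚ 5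
    variance≤ = ℚP.*-monoʳ-≤-nonNeg (M ^ℚ 5) {{ℚ.nonNegative (^-nonNeg 5 (⟦⟧-nonNeg m))}}
                  (^-mono-≤ 4 σ²-nonNeg σ²≤S²)
    embed : ⟦ windowBound b S m ⟧ ≡ B ^ℚ 8 ℚ.* (⟦ S * S ⟧ ^ℚ 4 ℚ.* M ^ℚ 5)
    embed = begin-equality
      ⟦ b ^ 8 * ((S * S) ^ 4 * m ^ 5) ⟧             ≡⟨ ⟦*⟧ (b ^ 8) _ ⟩
      ⟦ b ^ 8 ⟧ ℚ.* ⟦ (S * S) ^ 4 * m ^ 5 ⟧         ≡⟨ cong₂ ℚ._*_ (⟦^⟧ b 8) (⟦*⟧ ((S * S) ^ 4) (m ^ 5)) ⟩
      B ^ℚ 8 ℚ.* (⟦ (S * S) ^ 4 ⟧ ℚ.* ⟦ m ^ 5 ⟧)     ≡⟨ cong (B ^ℚ 8 ℚ.*_) (cong₂ ℚ._*_ (⟦^⟧ (S * S) 4) (⟦^⟧ m 5)) ⟩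
      B ^ℚ 8 ℚ.* (⟦ S * S ⟧ ^ℚ 4 ℚ.* M ^ℚ 5)         ∎

  window-gap : ∀ m k d → inHappyWindow b h m k →
               d + b * k ≤ S * m ⊎ d + S * m ≤ b * k → d ^ 8 ≤ windowBound b S m
  window-gap m k d window gap = ⟦⟧-cancel-≤ (begin
    ⟦ d ^ 8 ⟧                           ≡⟨ ⟦^⟧ d 8 ⟩
    ⟦ d ⟧ ^ℚ 8                          ≤⟨ gap⇒^8-≤ d (b * k) (S * m) gap ⟩
    (⟦ b * k ⟧ ℚ.- ⟦ S * m ⟧) ^ℚ 8      ≤⟨ window⇒scaled m k window ⟩
    ⟦ windowBound b S m ⟧               ∎)
    where open ℚP.≤-Reasoning

  -- If W < q^8 at the centre m of [lo, lo + 2q], the window of m lies in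
  -- [lo, lo + 2q): points outside are mapped at distance ≥ q from S·m.
  window-near-centre : ∀ lo q .{{_ : NonZero S}} → 1 < b → S ≤ q →
                       windowBound b S (centre b S lo q) < q ^ 8 →
                       ∀ k → inHappyWindow b h (centre b S lo q) k → lo ≤ k × k < lo + q * 2
  window-near-centre lo q 1<b S≤q W<q^8 k window =
      ℕP.≮⇒≥ (λ k<lo → excluded (inj₁ (centre-left b S lo q 1<b S≤q k (ℕP.<⇒≤ k<lo))))
    , ℕP.≰⇒> (λ lo+2q≤k → excluded (inj₂ (centre-right b S lo q (ℕP.<⇒≤ 1<b) k lo+2q≤k)))
    where
    excluded : q + b * k ≤ S * centre b S lo q ⊎ q + S * centre b S lo q ≤ b * k → ⊥
    excluded gap = ℕP.<⇒≱ W<q^8 (window-gap (centre b S lo q) k q window gap)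

lemma4p2 : (b : ℕ) .{{_ : NonZero b}} → 1 < b → (h : ℕ → ℕ) → h 0 ≡ 0 → h 1 ≡ 1 →
    ∃[ N ] ((n : ℕ) → N < n → (lo hi : ℕ) → nStrict b n lo hi →
      ∃[ m ] (1 ≤ m × ((k : ℕ) → inHappyWindow b h m k → lo ≤ k × k ≤ hi)))
lemma4p2 b 1<b h _ h1≡1 = threshold b S , fits
  where
  open DigitStatistics b h

  1≤S : 1 ≤ S
  1≤S = subst (_≤ S) h1≡1 (term≤Σ<ℕ h b 1 1<b)

  instance
    S≢0 : NonZero S
    S≢0 = >-nonZero 1≤S

  fits : (n : ℕ) → threshold b S < n → (lo hi : ℕ) → nStrict b n lo hi →
         ∃[ m ] (1 ≤ m × ((k : ℕ) → inHappyWindow b h m k → lo ≤ k × k ≤ hi))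
  fits n N<n lo hi strictness@(_ , lo≤hi , _ , _) = m , centre-positive b S lo q (ℕP.<⇒≤ 1<b) S≤radius , inside
    where
    open StrictInterval b S n lo hi 1<b N<n strictness
    q = radius lo hi
    m = centre b S lo q

    m≤b*b^n : m ≤ b * b ^ n
    m≤b*b^n = ℕP.≤-trans (centre≤ b S lo q) (ℕP.*-monoʳ-≤ b (midpoint≤b^n b n lo hi strictness))

    inside : (k : ℕ) → inHappyWindow b h m k → lo ≤ k × k ≤ hi
    inside k window =
      let lo≤k , k<lo+2q = window-near-centre lo q 1<b S≤radius (radius-dominates 1≤S m m≤b*b^n) k window
      in  lo≤k , ℕP.≤-pred (ℕP.<-≤-trans k<lo+2q (radius-fits lo hi lo≤hi))
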